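{- For every finite simple graph $G$, \[ \delta(G)\alpha(G) \le \Delta(G)\mu(G), \] and this inequality is sharp (equality holds for some graphs with $\delta(G) \ge 1$).
   Context: $\delta(G)$ and $\Delta(G)$ denote the minimum and maximum vertex degrees of $G$; $\alpha(G)$ is the independence number and $\mu(G)$ the matching number (maximum size of a matching) of $G$. -}

module Defs where

open import Data.Nat using (ℕ; zero; suc; _+_; _≤_; _⊔_; _⊓_)
open import Data.Bool using (Bool; true; false; if_then_else_)
open import Data.Fin using (Fin)
open import Data.Fin.Subset using (Subset; _∈_; ∣_∣)
open import Data.List using (List; length; []; _∷_)
open import Data.List.Relation.Unary.All using (All)
open import Data.List.Relation.Unary.AllPairs using (AllPairs)
open import Data.Product using (Σ; _×_; _,_; ∃)
open import Relation.Binary.PropositionalEquality using (_≡_; _≢_)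
open import Relation.Nullary using (¬_)

record Graph (n : ℕ) : Set where
  field
    adj   : Fin n → Fin n → Bool
    sym   : ∀ u v → adj u v ≡ adj v u
    irrefl : ∀ v → adj v v ≡ false
open Graph public

Adj : ∀ {n} → Graph n → Fin n → Fin n → Set
Adj G u v = adj G u v ≡ true

countFin : ∀ {n} → (Fin n → Bool) → ℕ
countFin {zero}  p = 0
countFin {suc n} p = (if p Fin.zero then 1 else 0) + countFin (λ i → p (Fin.suc i))

degree : ∀ {n} → Graph n → Fin n → ℕ
degree G v = countFin (adj G v)

-- maximum and minimum of f over Fin n (0 for the empty vertex set)
maxFin : ∀ {n} → (Fin n → ℕ) → ℕ
maxFin {zero}  f = 0
maxFin {suc n} f = f Fin.zero ⊔ maxFin (λ i → f (Fin.suc i))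

minFin : ∀ {n} → (Fin n → ℕ) → ℕ
minFin {zero}  f = 0
minFin {suc zero} f = f Fin.zero
minFin {suc (suc n)} f = f Fin.zero ⊓ minFin (λ i → f (Fin.suc i))

minDegree : ∀ {n} → Graph n → ℕ
minDegree G = minFin (degree G)

maxDegree : ∀ {n} → Graph n → ℕ
maxDegree G = maxFin (degree G)

Independent : ∀ {n} → Graph n → Subset n → Set
Independent G S = ∀ u v → u ∈ S → v ∈ S → ¬ Adj G u v

IsIndependenceNumber : ∀ {n} → Graph n → ℕ → Set
IsIndependenceNumber G a =
  (Σ (Subset _) λ S → Independent G S × ∣ S ∣ ≡ a) ×
  (∀ S → Independent G S → ∣ S ∣ ≤ a)

Edge : ℕ → Set
Edge n = Fin n × Fin n

Disjoint : ∀ {n} → Edge n → Edge n → Set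
Disjoint (a , b) (c , d) = a ≢ c × a ≢ d × b ≢ c × b ≢ d

IsMatching : ∀ {n} → Graph n → List (Edge n) → Set
IsMatching G M = All (λ { (u , v) → Adj G u v }) M × AllPairs Disjoint M

IsMatchingNumber : ∀ {n} → Graph n → ℕ → Set
IsMatchingNumber G m =
  (Σ (List (Edge _)) λ M → IsMatching G M × length M ≡ m) ×
  (∀ M → IsMatching G M → length M ≤ m)

-- Let S be a maximum independent set and H the bipartite graph formed by the edges of G leaving S,
-- with S on the left and a copy of V(G) on the right. H has at least δα edges and every vertex of
-- H meets at most Δ of them, so every vertex cover of H has at least δα/Δ vertices. By König's
-- theorem H has a matching as large as a minimum cover; its left endpoints lie in S and its right
-- endpoints outside S, so it is also a matching of G, whence Δμ ≥ δα.
--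
-- König's theorem is proved by Rizzi's induction on the number of edges: a left vertex with three
-- right neighbours is handled by deleting a vertex or an edge, one with exactly two by contracting
-- them, and if no vertex on either side has two distinct neighbours the edges already form a matching.

module Submission where

open import Defs hiding (sym)
open import Data.Bool using (Bool; true; false; _∧_; if_then_else_)
open import Data.Bool.Properties using (∧-conicalˡ; ∧-conicalʳ)
open import Data.Empty using (⊥; ⊥-elim)
open import Data.Fin using (Fin; zero; suc)
import Data.Fin.Properties as Fin
open import Data.Fin.Subset using (Subset; ∣_∣) renaming (_∈_ to _∈ₛ_)
open import Data.Vec using ([]; _∷_; here; there; lookup)
open import Data.Vec.Properties using ([]=⇒lookup; lookup⇒[]=)
open import Data.List using (List; []; _∷_; length; map; filter; _++_)
open import Data.List.Properties using (length-map; length-++; length-filter; filter-++; filter-notAll; filter-≐; filter-none; filter-all)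
open import Data.List.Membership.Propositional using (_∈_; _∉_; find; lose)
open import Data.List.Membership.Propositional.Properties using (∈-map⁺; ∈-map⁻; ∈-filter⁺; ∈-filter⁻; ∈-++⁻)
import Data.List.Membership.DecPropositional as DecMembership
open import Data.List.Relation.Binary.Subset.Propositional using (_⊆_)
import Data.List.Relation.Binary.Sublist.Propositional.Properties as Sublist
open import Data.List.Relation.Unary.All as All using (All; []; _∷_)
open import Data.List.Relation.Unary.All.Properties using (all-filter)
open import Data.List.Relation.Unary.Any as Any using (Any; here; there; any?)
open import Data.List.Relation.Unary.Any.Properties using (map⁺)
open import Data.List.Relation.Unary.AllPairs as AllPairs using (AllPairs; []; _∷_)
import Data.List.Relation.Unary.AllPairs.Properties as AllPairs
open import Data.Nat using (ℕ; zero; suc; _+_; _*_; _≤_; _<_; _≥_; z≤n; s≤s; _≤?_)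
open import Data.Nat.Induction using (<-wellFounded)
open import Data.Nat.Properties
open import Data.Product using (Σ; ∃; _×_; _,_; proj₁; proj₂; map₁; map₂; swap)
import Data.Product.Properties as Product
open import Data.Sum using (_⊎_; inj₁; inj₂)
import Data.Sum as Sum
import Data.Sum.Properties as Sum
open import Function using (_∘_; id)
import Induction.WellFounded as WF
open import Relation.Binary.Construct.On as On using ()
open import Relation.Binary.Definitions using (DecidableEquality)
open import Relation.Binary.PropositionalEquality using (_≡_; _≢_; refl; sym; trans; cong; cong₂; subst; module ≡-Reasoning)
open import Relation.Nullary using (¬_; Dec; does; yes; no; ¬?; _×-dec_)
open import Relation.Unary using (Decidable)

module _ {A : Set} {P : A → Set} (P? : Decidable P) where

  length-filter-split : ∀ xs → length xs ≡ length (filter P? xs) + length (filter (¬? ∘ P?) xs)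
  length-filter-split [] = refl
  length-filter-split (x ∷ xs) with P? x
  ... | yes _ = cong suc (length-filter-split xs)
  ... | no _ = trans (cong suc (length-filter-split xs)) (sym (+-suc _ _))

  length-filter-mono : ∀ {Q : A → Set} (Q? : Decidable Q) xs →
                       length (filter P? (filter Q? xs)) ≤ length (filter P? xs)
  length-filter-mono Q? xs =
    Sublist.length-mono-≤ (Sublist.filter⁺ P? P? (λ { refl p → p }) (Sublist.filter-⊆ Q? xs))

module _ {A B : Set} {R : A → B → Set} (R? : ∀ a b → Dec (R a b)) where

  length≤cover*bound : ∀ (D : ℕ) C E → (∀ {e} → e ∈ E → Any (R e) C) →
                       (∀ c → length (filter (λ e → R? e c) E) ≤ D) → length E ≤ length C * D
  length≤cover*bound D [] [] covered bounded = z≤n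
  length≤cover*bound D [] (e ∷ E) covered bounded with covered (here refl)
  ... | ()
  length≤cover*bound D (c ∷ C) E covered bounded = begin
      length E                                                ≡⟨ length-filter-split (λ e → R? e c) E ⟩
      length (filter (λ e → R? e c) E) + length uncovered     ≤⟨ +-mono-≤ (bounded c) uncovered-bound ⟩
      D + length C * D                                        ∎
    where
    open ≤-Reasoning
    uncovered : List A
    uncovered = filter (λ e → ¬? (R? e c)) E
    uncovered-bound : length uncovered ≤ length C * D
    uncovered-bound = length≤cover*bound D C uncovered covered′ bounded′
      where
      covered′ : ∀ {e} → e ∈ uncovered → Any (R e) C
      covered′ e∈ with ∈-filter⁻ (λ e → ¬? (R? e c)) {xs = E} e∈
      ... | e∈E , ¬Rec with covered e∈E
      ...   | here Rec = ⊥-elim (¬Rec Rec)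
      ...   | there hit = hit
      bounded′ : ∀ c′ → length (filter (λ e → R? e c′) uncovered) ≤ D
      bounded′ c′ = ≤-trans (length-filter-mono (λ e → R? e c′) (λ e → ¬? (R? e c)) E) (bounded c′)

module _ {A : Set} {R : A → A → Set} where

  allPairs-∈ : ∀ {xs x y} → AllPairs R xs → x ∈ xs → y ∈ xs → x ≡ y ⊎ R x y ⊎ R y x
  allPairs-∈ (_ ∷ _) (here refl) (here refl) = inj₁ refl
  allPairs-∈ (Rx ∷ _) (here refl) (there y∈) = inj₂ (inj₁ (All.lookup Rx y∈))
  allPairs-∈ (Rx ∷ _) (there x∈) (here refl) = inj₂ (inj₂ (All.lookup Rx x∈))
  allPairs-∈ (_ ∷ Rxs) (there x∈) (there y∈) = allPairs-∈ Rxs x∈ y∈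

allPairs-refine : ∀ {A : Set} {P : A → Set} {R Q : A → A → Set} →
                  (∀ {x y} → P x → P y → R x y → Q x y) → ∀ {xs} → All P xs → AllPairs R xs → AllPairs Q xs
allPairs-refine refine [] [] = []
allPairs-refine refine (px ∷ pxs) (rxs ∷ rs) =
  All.zipWith (λ (py , rxy) → refine px py rxy) (pxs , rxs) ∷ allPairs-refine refine pxs rs

⊆-map⁻ : ∀ {A B : Set} (f : A → B) {M E} → M ⊆ map f E → ∃ λ L → L ⊆ E × map f L ≡ M
⊆-map⁻ f {[]} M⊆ = [] , (λ ()) , refl
⊆-map⁻ f {x ∷ M} M⊆ with ∈-map⁻ f (M⊆ (here refl)) | ⊆-map⁻ f (M⊆ ∘ there)
... | y , y∈ , refl | L , L⊆ , refl = y ∷ L , (λ { (here refl) → y∈ ; (there z∈) → L⊆ z∈ }) , refl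

-- A bipartite graph is a list of (left, right) edges, possibly repeated, over a common vertex type;
-- cover vertices are tagged inj₁ (left) or inj₂ (right).
module König {V : Set} (_≟_ : DecidableEquality V) where

  _≟ᵉ_ : DecidableEquality (V × V)
  _≟ᵉ_ = Product.≡-dec _≟_ _≟_

  _≟ˢ_ : DecidableEquality (V ⊎ V)
  _≟ˢ_ = Sum.≡-dec _≟_ _≟_

  open DecMembership _≟ᵉ_ using () renaming (_∈?_ to _∈ᵉ?_)
  open DecMembership _≟ˢ_ using () renaming (_∈?_ to _∈ˢ?_)

  Separated : V × V → V × V → Set
  Separated e f = proj₁ e ≢ proj₁ f × proj₂ e ≢ proj₂ f

  Matching : List (V × V) → Set
  Matching = AllPairs Separated

  Hits : V × V → V ⊎ V → Set
  Hits (a , _) (inj₁ c) = a ≡ c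
  Hits (_ , b) (inj₂ c) = b ≡ c

  hits? : ∀ e c → Dec (Hits e c)
  hits? (a , _) (inj₁ c) = a ≟ c
  hits? (_ , b) (inj₂ c) = b ≟ c

  Covers : List (V ⊎ V) → List (V × V) → Set
  Covers C E = ∀ {e} → e ∈ E → Any (Hits e) C

  record MatchingCover (E : List (V × V)) : Set where
    field
      matching       : List (V × V)
      isMatching     : Matching matching
      matching⊆      : matching ⊆ E
      cover          : List (V ⊎ V)
      covers         : Covers cover E
      cover≤matching : length cover ≤ length matching

  module _ {M : List (V × V)} (M-matching : Matching M) {e f : V × V} (e∈ : e ∈ M) (f∈ : f ∈ M) where

    matching-injective₁ : proj₁ e ≡ proj₁ f → e ≡ f
    matching-injective₁ eq with allPairs-∈ M-matching e∈ f∈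
    ... | inj₁ e≡f = e≡f
    ... | inj₂ (inj₁ sep) = ⊥-elim (proj₁ sep eq)
    ... | inj₂ (inj₂ sep) = ⊥-elim (proj₁ sep (sym eq))

    matching-injective₂ : proj₂ e ≡ proj₂ f → e ≡ f
    matching-injective₂ eq with allPairs-∈ M-matching e∈ f∈
    ... | inj₁ e≡f = e≡f
    ... | inj₂ (inj₁ sep) = ⊥-elim (proj₂ sep eq)
    ... | inj₂ (inj₂ sep) = ⊥-elim (proj₂ sep (sym eq))

  separated-¬hits-same : ∀ {e f} c → Separated e f → Hits e c → Hits f c → ⊥
  separated-¬hits-same (inj₁ _) sep refl refl = proj₁ sep refl
  separated-¬hits-same (inj₂ _) sep refl refl = proj₂ sep refl

  separated-hitting≤1 : ∀ {L} c → Matching L → All (λ e → Hits e c) L → length L ≤ 1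
  separated-hitting≤1 c [] [] = z≤n
  separated-hitting≤1 c (_ ∷ []) (_ ∷ []) = ≤-refl
  separated-hitting≤1 c ((sep ∷ _) ∷ _) (he ∷ hf ∷ _) = ⊥-elim (separated-¬hits-same c sep he hf)

  matching≤cover : ∀ {M C} → Matching M → Covers C M → length M ≤ length C
  matching≤cover {M} {C} M-matching covered = begin
    length M      ≤⟨ length≤cover*bound hits? 1 C M covered hits≤1 ⟩
    length C * 1  ≡⟨ *-identityʳ (length C) ⟩
    length C      ∎
    where
    open ≤-Reasoning
    hits≤1 : ∀ c → length (filter (λ e → hits? e c) M) ≤ 1
    hits≤1 c = separated-hitting≤1 c (AllPairs.filter⁺ (λ e → hits? e c) M-matching)
                                     (all-filter (λ e → hits? e c) M)

  matching<cover : ∀ {M C c} → Matching M → Covers C M → c ∈ C → (∀ {e} → e ∈ M → ¬ Hits e c) →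
                   length M < length C
  matching<cover {M} {C} {c} M-matching covered c∈ unused = begin-strict
    length M         ≤⟨ matching≤cover M-matching covered′ ⟩
    length C′        <⟨ filter-notAll (λ d → ¬? (d ≟ˢ c)) C (Any.map (λ { refl ¬c≢c → ¬c≢c refl }) c∈) ⟩
    length C         ∎
    where
    open ≤-Reasoning
    C′ : List (V ⊎ V)
    C′ = filter (λ d → ¬? (d ≟ˢ c)) C
    covered′ : Covers C′ M
    covered′ e∈ with find (covered e∈)
    ... | d , d∈ , hit = lose (∈-filter⁺ (λ d → ¬? (d ≟ˢ c)) d∈ (λ { refl → unused e∈ hit })) hit

  left∈cover : ∀ {a b C} → Any (Hits (a , b)) C → inj₂ b ∉ C → inj₁ a ∈ C
  left∈cover {C = inj₁ _ ∷ _} (here refl) b∉ = here refl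
  left∈cover {C = inj₂ _ ∷ _} (here refl) b∉ = ⊥-elim (b∉ (here refl))
  left∈cover (there hit) b∉ = there (left∈cover hit (b∉ ∘ there))

  withoutVertex : V ⊎ V → List (V × V) → List (V × V)
  withoutVertex c = filter (λ e → ¬? (hits? e c))

  withoutEdge : V × V → List (V × V) → List (V × V)
  withoutEdge f = filter (λ e → ¬? (e ≟ᵉ f))

  module _ (c : V ⊎ V) (E : List (V × V)) where

    ∈-withoutVertex⁻ : ∀ {e} → e ∈ withoutVertex c E → e ∈ E × ¬ Hits e c
    ∈-withoutVertex⁻ = ∈-filter⁻ (λ e → ¬? (hits? e c)) {xs = E}

    ∈-withoutVertex⁺ : ∀ {e} → e ∈ E → ¬ Hits e c → e ∈ withoutVertex c E
    ∈-withoutVertex⁺ = ∈-filter⁺ (λ e → ¬? (hits? e c))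

    withoutVertex-< : ∀ {e} → e ∈ E → Hits e c → length (withoutVertex c E) < length E
    withoutVertex-< e∈ hit = filter-notAll (λ e → ¬? (hits? e c)) E (lose e∈ (λ ¬hit → ¬hit hit))

  module _ (f : V × V) (E : List (V × V)) where

    ∈-withoutEdge⁻ : ∀ {e} → e ∈ withoutEdge f E → e ∈ E × e ≢ f
    ∈-withoutEdge⁻ = ∈-filter⁻ (λ e → ¬? (e ≟ᵉ f)) {xs = E}

    ∈-withoutEdge⁺ : ∀ {e} → e ∈ E → e ≢ f → e ∈ withoutEdge f E
    ∈-withoutEdge⁺ = ∈-filter⁺ (λ e → ¬? (e ≟ᵉ f))

    withoutEdge-< : f ∈ E → length (withoutEdge f E) < length E
    withoutEdge-< f∈ = filter-notAll (λ e → ¬? (e ≟ᵉ f)) E (lose f∈ (λ f≢f → f≢f refl))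

  MatchingCoverBelow : List (V × V) → Set
  MatchingCoverBelow E = ∀ {E′} → length E′ < length E → MatchingCover E′

  -- Rizzi's argument for a left vertex u with at least three right neighbours.
  module EdgeDeletion {E : List (V × V)} (below : MatchingCoverBelow E) {u v : V} (uv∈ : (u , v) ∈ E) where
    open MatchingCover (below {withoutVertex (inj₂ v) E} (withoutVertex-< (inj₂ v) E uv∈ refl))
      renaming (matching to M₁; isMatching to M₁-matching; matching⊆ to M₁⊆;
                cover to C₁; covers to C₁-covers; cover≤matching to C₁≤M₁)

    module _ {s : V} (us∈ : (u , s) ∈ E) (s≢v : s ≢ v) (us∉M₁ : (u , s) ∉ M₁) where
      open MatchingCover (below {withoutEdge (u , s) E} (withoutEdge-< (u , s) E us∈))
        renaming (matching to M₂; isMatching to M₂-matching; matching⊆ to M₂⊆;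
                  cover to C₂; covers to C₂-covers; cover≤matching to C₂≤M₂)

      addRightV : length M₁ < length M₂ → MatchingCover E
      addRightV M₁<M₂ = record
        { matching = M₂ ; isMatching = M₂-matching ; matching⊆ = proj₁ ∘ ∈-withoutEdge⁻ (u , s) E ∘ M₂⊆
        ; cover = inj₂ v ∷ C₁ ; covers = covers ; cover≤matching = ≤-trans (s≤s C₁≤M₁) M₁<M₂ }
        where
        covers : Covers (inj₂ v ∷ C₁) E
        covers {e} e∈ with hits? e (inj₂ v)
        ... | yes hit = here hit
        ... | no ¬hit = there (C₁-covers (∈-withoutVertex⁺ (inj₂ v) E e∈ ¬hit))

      -- A cover of E − (u , s) no larger than M₁ cannot contain v, which M₁ avoids;
      -- so it contains u, and then also covers (u , s).
      keepM₁ : length M₂ ≤ length M₁ → MatchingCover E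
      keepM₁ M₂≤M₁ = record
        { matching = M₁ ; isMatching = M₁-matching ; matching⊆ = proj₁ ∘ ∈-withoutVertex⁻ (inj₂ v) E ∘ M₁⊆
        ; cover = C₂ ; covers = covers ; cover≤matching = ≤-trans C₂≤M₂ M₂≤M₁ }
        where
        M₁⊆E₂ : M₁ ⊆ withoutEdge (u , s) E
        M₁⊆E₂ e∈ = ∈-withoutEdge⁺ (u , s) E (proj₁ (∈-withoutVertex⁻ (inj₂ v) E (M₁⊆ e∈))) (λ { refl → us∉M₁ e∈ })
        v∉C₂ : inj₂ v ∉ C₂
        v∉C₂ v∈ = <⇒≱ (matching<cover M₁-matching (C₂-covers ∘ M₁⊆E₂) v∈ (proj₂ ∘ ∈-withoutVertex⁻ (inj₂ v) E ∘ M₁⊆))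
                      (≤-trans C₂≤M₂ M₂≤M₁)
        u∈C₂ : inj₁ u ∈ C₂
        u∈C₂ = left∈cover (C₂-covers (∈-withoutEdge⁺ (u , s) E uv∈ (λ eq → s≢v (sym (cong proj₂ eq))))) v∉C₂
        covers : Covers C₂ E
        covers {e} e∈ with e ≟ᵉ (u , s)
        ... | yes refl = lose {P = Hits (u , s)} u∈C₂ refl
        ... | no e≢us = C₂-covers (∈-withoutEdge⁺ (u , s) E e∈ e≢us)

      viaUnmatchedEdge : MatchingCover E
      viaUnmatchedEdge with suc (length M₁) ≤? length M₂
      ... | yes M₁<M₂ = addRightV M₁<M₂
      ... | no M₁≮M₂ = keepM₁ (≤-pred (≰⇒> M₁≮M₂))

    matchingCover : ∀ {w z} → (u , w) ∈ E → (u , z) ∈ E → w ≢ v → z ≢ v → z ≢ w → MatchingCover E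
    matchingCover {w} {z} uw∈ uz∈ w≢v z≢v z≢w with (u , w) ∈ᵉ? M₁
    ... | yes uw∈M₁ = viaUnmatchedEdge uz∈ z≢v
                        (λ uz∈M₁ → z≢w (cong proj₂ (matching-injective₁ M₁-matching uz∈M₁ uw∈M₁ refl)))
    ... | no uw∉M₁ = viaUnmatchedEdge uw∈ w≢v uw∉M₁

  -- u has exactly the right neighbours v and w: delete u, merge w into v, and lift back.
  module Contraction {E : List (V × V)} (below : MatchingCoverBelow E) {u v w : V}
           (uv∈ : (u , v) ∈ E) (uw∈ : (u , w) ∈ E) (v≢w : v ≢ w)
           (neighbours : ∀ {b} → (u , b) ∈ E → b ≡ v ⊎ b ≡ w) where

    merge : V → V
    merge b = if does (b ≟ w) then v else b

    merge-w : merge w ≡ v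
    merge-w with w ≟ w
    ... | yes _ = refl
    ... | no w≢w = ⊥-elim (w≢w refl)

    merge-v : merge v ≡ v
    merge-v with v ≟ w
    ... | yes _ = refl
    ... | no _ = refl

    contract : V × V → V × V
    contract (a , b) = a , merge b

    contracted : List (V × V)
    contracted = map contract (withoutVertex (inj₁ u) E)

    contracted-< : length contracted < length E
    contracted-< = subst (_< length E) (sym (length-map contract (withoutVertex (inj₁ u) E))) (withoutVertex-< (inj₁ u) E uv∈ refl)

    unmerge : ∀ e d → Hits (contract e) d → Hits e d ⊎ (proj₂ e ≡ w × d ≡ inj₂ v)
    unmerge e (inj₁ c) hit = inj₁ hit
    unmerge (a , b) (inj₂ c) hit with b ≟ w
    ... | yes b≡w = inj₂ (b≡w , cong inj₂ (sym hit))
    ... | no _ = inj₁ hit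

    contract-covered : ∀ {e C} → Any (Hits (contract e)) C → Any (Hits e) C ⊎ (proj₂ e ≡ w × inj₂ v ∈ C)
    contract-covered {e} (here hit) with unmerge e _ hit
    ... | inj₁ hit′ = inj₁ (here hit′)
    ... | inj₂ (b≡w , d≡v) = inj₂ (b≡w , here (sym d≡v))
    contract-covered (there hits) = Sum.map there (map₂ there) (contract-covered hits)

    -- v ∈ C′ means the merged vertex is in the cover: split it into v and w; otherwise add u.
    liftCover : ∀ {C′} → Covers C′ contracted → ∃ λ C → Covers C E × length C ≡ suc (length C′)
    liftCover {C′} C′-covers with inj₂ v ∈ˢ? C′
    ... | yes v∈ = inj₂ w ∷ C′ , covers , refl
      where
      covers : Covers (inj₂ w ∷ C′) E
      covers {e} e∈ with proj₁ e ≟ u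
      ... | yes refl with neighbours e∈
      ...   | inj₁ b≡v = there (lose {P = Hits e} v∈ b≡v)
      ...   | inj₂ b≡w = here b≡w
      covers {e} e∈ | no a≢u with contract-covered (C′-covers (∈-map⁺ contract (∈-withoutVertex⁺ (inj₁ u) E e∈ a≢u)))
      ... | inj₁ hits = there hits
      ... | inj₂ (b≡w , _) = here b≡w
    ... | no v∉ = inj₁ u ∷ C′ , covers , refl
      where
      covers : Covers (inj₁ u ∷ C′) E
      covers {e} e∈ with proj₁ e ≟ u
      ... | yes a≡u = here a≡u
      ... | no a≢u with contract-covered (C′-covers (∈-map⁺ contract (∈-withoutVertex⁺ (inj₁ u) E e∈ a≢u)))
      ...   | inj₁ hits = there hits
      ...   | inj₂ (_ , v∈) = ⊥-elim (v∉ v∈)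

    module _ {L : List (V × V)} (L⊆ : L ⊆ withoutVertex (inj₁ u) E) (L-matching′ : Matching (map contract L)) where

      L-matching : Matching L
      L-matching = AllPairs.map (λ sep → proj₁ sep , proj₂ sep ∘ cong merge) (AllPairs.map⁻ L-matching′)

      L-avoids-u : ∀ {e} → e ∈ L → proj₁ e ≢ u
      L-avoids-u = proj₂ ∘ ∈-withoutVertex⁻ (inj₁ u) E ∘ L⊆

      -- both contract to a right endpoint v, which the matching uses only once
      ¬w-and-v : ∀ {g h} → g ∈ L → h ∈ L → proj₂ g ≡ w → proj₂ h ≡ v → ⊥
      ¬w-and-v {g} {h} g∈ h∈ refl refl = v≢w (sym (cong proj₂ g≡h))
        where
        contract-g≡h : contract g ≡ contract h
        contract-g≡h = matching-injective₂ L-matching′ (∈-map⁺ contract g∈) (∈-map⁺ contract h∈)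
                                           (trans merge-w (sym merge-v))
        g≡h : g ≡ h
        g≡h = matching-injective₁ L-matching g∈ h∈ (cong proj₁ contract-g≡h)

      extendedMatching : ∃ λ t → (u , t) ∈ E × All (Separated (u , t)) L
      extendedMatching with any? (λ e → proj₂ e ≟ w) L
      ... | yes w-used = v , uv∈ , All.tabulate λ h∈ →
              (λ u≡ → L-avoids-u h∈ (sym u≡)) ,
              (λ v≡ → let _ , g∈ , g≡w = find w-used in ¬w-and-v g∈ h∈ g≡w (sym v≡))
      ... | no w-free = w , uw∈ , All.tabulate λ h∈ →
              (λ u≡ → L-avoids-u h∈ (sym u≡)) ,
              (λ w≡ → w-free (lose h∈ (sym w≡)))

      liftMatchingCover : ∀ {C′} → Covers C′ contracted → length C′ ≤ length L → MatchingCover E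
      liftMatchingCover C′-covers C′≤L with extendedMatching | liftCover C′-covers
      ... | t , ut∈ , t-separated | C , C-covers , ∣C∣≡ = record
        { matching = (u , t) ∷ L
        ; isMatching = t-separated ∷ L-matching
        ; matching⊆ = λ { (here refl) → ut∈ ; (there e∈) → proj₁ (∈-withoutVertex⁻ (inj₁ u) E (L⊆ e∈)) }
        ; cover = C
        ; covers = C-covers
        ; cover≤matching = ≤-trans (≤-reflexive ∣C∣≡) (s≤s C′≤L)
        }

    lift : MatchingCover contracted → MatchingCover E
    lift K′ with ⊆-map⁻ contract (MatchingCover.matching⊆ K′)
    ... | L , L⊆ , refl = liftMatchingCover L⊆ isMatching covers
                            (subst (length cover ≤_) (length-map contract L) cover≤matching)
      where open MatchingCover K′

    matchingCover : MatchingCover E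
    matchingCover = lift (below contracted-<)

  byDeduplication : ∀ {E} → MatchingCoverBelow E →
                    (∀ {e f} → e ∈ E → f ∈ E → proj₁ e ≡ proj₁ f → e ≡ f) →
                    (∀ {e f} → e ∈ E → f ∈ E → proj₂ e ≡ proj₂ f → e ≡ f) → MatchingCover E
  byDeduplication {[]} below _ _ = record
    { matching = [] ; isMatching = [] ; matching⊆ = λ () ; cover = [] ; covers = λ () ; cover≤matching = z≤n }
  byDeduplication {e ∷ E} below left-injective right-injective = record
    { matching = e ∷ matching
    ; isMatching = All.tabulate separated ∷ isMatching
    ; matching⊆ = λ { (here refl) → here refl ; (there f∈) → there (proj₁ (∈-withoutEdge⁻ e E (matching⊆ f∈))) }
    ; cover = inj₁ (proj₁ e) ∷ cover
    ; covers = covers′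
    ; cover≤matching = s≤s cover≤matching
    }
    where
    open MatchingCover (below {withoutEdge e E} (s≤s (length-filter (λ f → ¬? (f ≟ᵉ e)) E)))
    separated : ∀ {f} → f ∈ matching → Separated e f
    separated f∈ with ∈-withoutEdge⁻ e E (matching⊆ f∈)
    ... | f∈E , f≢e = (λ eq → f≢e (sym (left-injective (here refl) (there f∈E) eq))) ,
                      (λ eq → f≢e (sym (right-injective (here refl) (there f∈E) eq)))
    covers′ : Covers (inj₁ (proj₁ e) ∷ cover) (e ∷ E)
    covers′ (here refl) = here refl
    covers′ {g} (there g∈) with g ≟ᵉ e
    ... | yes refl = here refl
    ... | no g≢e = there (covers (∈-withoutEdge⁺ e E g∈ g≢e))

  swap-hits : ∀ {e} d → Hits (swap e) d → Hits e (Sum.swap d)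
  swap-hits (inj₁ _) hit = hit
  swap-hits (inj₂ _) hit = hit

  unswap : ∀ {E} → MatchingCover (map swap E) → MatchingCover E
  unswap {E} K = record
    { matching = map swap matching
    ; isMatching = AllPairs.map⁺ (AllPairs.map swap isMatching)
    ; matching⊆ = matching⊆′
    ; cover = map Sum.swap cover
    ; covers = λ e∈ → map⁺ (Any.map (λ {d} → swap-hits d) (covers (∈-map⁺ swap e∈)))
    ; cover≤matching = begin
        length (map Sum.swap cover) ≡⟨ length-map Sum.swap cover ⟩
        length cover                ≤⟨ cover≤matching ⟩
        length matching             ≡⟨ length-map swap matching ⟨
        length (map swap matching)  ∎
    }
    where
    open MatchingCover K
    open ≤-Reasoning
    matching⊆′ : map swap matching ⊆ E
    matching⊆′ e∈ with ∈-map⁻ swap e∈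
    ... | f , f∈ , refl with ∈-map⁻ swap (matching⊆ f∈)
    ...   | g , g∈ , refl = g∈

  Branching : List (V × V) → Set
  Branching E = Any (λ e → Any (λ f → proj₁ e ≡ proj₁ f × proj₂ e ≢ proj₂ f) E) E

  branching? : ∀ E → Dec (Branching E)
  branching? E = any? (λ e → any? (λ f → (proj₁ e ≟ proj₁ f) ×-dec ¬? (proj₂ e ≟ proj₂ f)) E) E

  ¬branching⇒injective : ∀ {E} → ¬ Branching E → ∀ {e f} → e ∈ E → f ∈ E → proj₁ e ≡ proj₁ f → e ≡ f
  ¬branching⇒injective ¬branching {e} {f} e∈ f∈ eq₁ with proj₂ e ≟ proj₂ f
  ... | yes eq₂ = cong₂ _,_ eq₁ eq₂
  ... | no ne = ⊥-elim (¬branching (lose e∈ (lose f∈ (eq₁ , ne))))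

  byTwoNeighbours : ∀ {E} → MatchingCoverBelow E → ∀ {u v w} → (u , v) ∈ E → (u , w) ∈ E → v ≢ w →
                    MatchingCover E
  byTwoNeighbours {E} below {u} {v} {w} uv∈ uw∈ v≢w
    with any? (λ g → (proj₁ g ≟ u) ×-dec (¬? (proj₂ g ≟ v) ×-dec ¬? (proj₂ g ≟ w))) E
  ... | yes third with find third
  ...   | (_ , z) , uz∈ , refl , z≢v , z≢w = EdgeDeletion.matchingCover below uv∈ uw∈ uz∈ (v≢w ∘ sym) z≢v z≢w
  byTwoNeighbours {E} below {u} {v} {w} uv∈ uw∈ v≢w | no ¬third =
    Contraction.matchingCover below uv∈ uw∈ v≢w neighbours
    where
    neighbours : ∀ {b} → (u , b) ∈ E → b ≡ v ⊎ b ≡ w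
    neighbours {b} ub∈ with b ≟ v | b ≟ w
    ... | yes b≡v | _ = inj₁ b≡v
    ... | no _ | yes b≡w = inj₂ b≡w
    ... | no b≢v | no b≢w = ⊥-elim (¬third (lose ub∈ (refl , b≢v , b≢w)))

  byBranching : ∀ {E} → MatchingCoverBelow E → Branching E → MatchingCover E
  byBranching below branching with find branching
  ... | (u , v) , uv∈ , w-branch with find w-branch
  ...   | (_ , w) , uw∈ , refl , v≢w = byTwoNeighbours below uv∈ uw∈ v≢w

  matchingCover : ∀ E → MatchingCover E
  matchingCover = WF.All.wfRec (On.wellFounded length <-wellFounded) _ MatchingCover step
    where
    step : ∀ E → MatchingCoverBelow E → MatchingCover E
    step E below with branching? E | branching? (map swap E)
    ... | yes branching | _ = byBranching below branching
    ... | no _ | yes branching = unswap (byBranching (λ lt → below (≤-trans lt (≤-reflexive (length-map swap E)))) branching)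
    ... | no ¬branching | no ¬branching′ = byDeduplication below (¬branching⇒injective ¬branching)
      (λ e∈ f∈ eq → cong swap (¬branching⇒injective ¬branching′ (∈-map⁺ swap e∈) (∈-map⁺ swap f∈) eq))

length-filter-map : ∀ {A B : Set} {P : B → Set} (P? : Decidable P) (f : A → B) xs →
                    length (filter P? (map f xs)) ≡ length (filter (P? ∘ f) xs)
length-filter-map P? f [] = refl
length-filter-map P? f (x ∷ xs) with P? (f x)
... | yes _ = cong suc (length-filter-map P? f xs)
... | no _ = length-filter-map P? f xs

length-filter-suc : ∀ {A : Set} {n} (g : A → Fin n) (c : Fin n) xs →
                    length (filter (λ x → suc (g x) Fin.≟ suc c) xs) ≡ length (filter (λ x → g x Fin.≟ c) xs)
length-filter-suc g c xs = cong length (filter-≐ (λ x → suc (g x) Fin.≟ suc c) (λ x → g x Fin.≟ c)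
                                                   (Fin.suc-injective , cong suc) xs)

length-filter-suc≟zero : ∀ {A : Set} {n} (g : A → Fin n) xs → length (filter (λ x → suc (g x) Fin.≟ zero) xs) ≡ 0
length-filter-suc≟zero g xs = cong length (filter-none _ (All.universal (λ _ ()) xs))

indicator : Bool → ℕ
indicator b = if b then 1 else 0

support : ∀ {n} → (Fin n → Bool) → List (Fin n)
support {zero} p = []
support {suc n} p = if p zero then zero ∷ rest else rest
  where rest = map suc (support (p ∘ suc))

length-support : ∀ {n} (p : Fin n → Bool) → length (support p) ≡ countFin p
length-support {zero} p = refl
length-support {suc n} p with p zero
... | true = cong suc (trans (length-map suc (support (p ∘ suc))) (length-support (p ∘ suc)))
... | false = trans (length-map suc (support (p ∘ suc))) (length-support (p ∘ suc))

∈-support⁻ : ∀ {n} (p : Fin n → Bool) {x} → x ∈ support p → p x ≡ true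
∈-support⁻ {suc n} p x∈ with p zero in p0
∈-support⁻ {suc n} p (here refl) | true = p0
∈-support⁻ {suc n} p (there x∈) | true with ∈-map⁻ suc x∈
... | y , y∈ , refl = ∈-support⁻ (p ∘ suc) y∈
∈-support⁻ {suc n} p x∈ | false with ∈-map⁻ suc x∈
... | y , y∈ , refl = ∈-support⁻ (p ∘ suc) y∈

count-map-suc-zero : ∀ {n} (xs : List (Fin n)) → length (filter (Fin._≟ zero) (map suc xs)) ≡ 0
count-map-suc-zero xs = trans (length-filter-map (Fin._≟ zero) suc xs) (length-filter-suc≟zero id xs)

count-map-suc : ∀ {n} (c : Fin n) xs → length (filter (Fin._≟ suc c) (map suc xs)) ≡ length (filter (Fin._≟ c) xs)
count-map-suc c xs = trans (length-filter-map (Fin._≟ suc c) suc xs) (length-filter-suc id c xs)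

count-support : ∀ {n} (p : Fin n → Bool) c → length (filter (Fin._≟ c) (support p)) ≡ indicator (p c)
count-support {suc n} p zero with p zero
... | true = cong suc (count-map-suc-zero (support (p ∘ suc)))
... | false = count-map-suc-zero (support (p ∘ suc))
count-support {suc n} p (suc c) with p zero
... | true = trans (count-map-suc c (support (p ∘ suc))) (count-support (p ∘ suc) c)
... | false = trans (count-map-suc c (support (p ∘ suc))) (count-support (p ∘ suc) c)

length-filter-++ : ∀ {A : Set} {P : A → Set} (P? : Decidable P) xs ys →
                   length (filter P? (xs ++ ys)) ≡ length (filter P? xs) + length (filter P? ys)
length-filter-++ P? xs ys = trans (cong length (filter-++ P? xs ys)) (length-++ (filter P? xs))

edgeList : ∀ {m n} → (Fin m → Fin n → Bool) → List (Fin m × Fin n)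
edgeList {zero} B = []
edgeList {suc m} B = map (zero ,_) (support (B zero)) ++ map (map₁ suc) (edgeList (B ∘ suc))

∈-edgeList⁻ : ∀ {m n} (B : Fin m → Fin n → Bool) {e} → e ∈ edgeList B → B (proj₁ e) (proj₂ e) ≡ true
∈-edgeList⁻ {suc m} B e∈ with ∈-++⁻ (map (zero ,_) (support (B zero))) e∈
... | inj₁ e∈₀ with ∈-map⁻ (zero ,_) e∈₀
...   | y , y∈ , refl = ∈-support⁻ (B zero) y∈
∈-edgeList⁻ {suc m} B e∈ | inj₂ e∈₊ with ∈-map⁻ (map₁ suc) e∈₊
...   | e′ , e′∈ , refl = ∈-edgeList⁻ (B ∘ suc) e′∈

module _ {m n} (B : Fin (suc m) → Fin n → Bool) where

  edgesAt₀ : List (Fin (suc m) × Fin n)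
  edgesAt₀ = map (zero ,_) (support (B zero))

  edgesAt₊ : List (Fin (suc m) × Fin n)
  edgesAt₊ = map (map₁ suc) (edgeList (B ∘ suc))

  length-edgeList : length (edgeList B) ≡ countFin (B zero) + length (edgeList (B ∘ suc))
  length-edgeList = begin
    length (edgesAt₀ ++ edgesAt₊)                      ≡⟨ length-++ edgesAt₀ ⟩
    length edgesAt₀ + length edgesAt₊                  ≡⟨ cong₂ _+_ (trans (length-map (zero ,_) (support (B zero)))
                                                                           (length-support (B zero)))
                                                                    (length-map (map₁ suc) (edgeList (B ∘ suc))) ⟩
    countFin (B zero) + length (edgeList (B ∘ suc))    ∎
    where open ≡-Reasoning

count₁-edgeList : ∀ {m n} (B : Fin m → Fin n → Bool) c →
             length (filter (λ e → proj₁ e Fin.≟ c) (edgeList B)) ≡ countFin (B c)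
count₁-edgeList {suc m} B c = begin
  length (filter P? (edgesAt₀ B ++ edgesAt₊ B))
    ≡⟨ length-filter-++ P? (edgesAt₀ B) (edgesAt₊ B) ⟩
  length (filter P? (edgesAt₀ B)) + length (filter P? (edgesAt₊ B))
    ≡⟨ cong₂ _+_ (length-filter-map P? (zero ,_) (support (B zero)))
                 (length-filter-map P? (map₁ suc) (edgeList (B ∘ suc))) ⟩
  length (filter (λ _ → zero Fin.≟ c) (support (B zero))) +
  length (filter (λ e → suc (proj₁ e) Fin.≟ c) (edgeList (B ∘ suc)))
    ≡⟨ split c ⟩
  countFin (B c) ∎
  where
  open ≡-Reasoning
  P? : ∀ e → Dec (proj₁ e ≡ c)
  P? e = proj₁ e Fin.≟ c
  split : ∀ c → length (filter (λ _ → zero Fin.≟ c) (support (B zero))) +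
                length (filter (λ e → suc (proj₁ e) Fin.≟ c) (edgeList (B ∘ suc))) ≡ countFin (B c)
  split zero = trans (cong₂ _+_ (trans (cong length (filter-all _ (All.universal (λ _ → refl) (support (B zero)))))
                                       (length-support (B zero)))
                                (length-filter-suc≟zero proj₁ (edgeList (B ∘ suc))))
                     (+-identityʳ _)
  split (suc c) = cong₂ _+_ (cong length (filter-none _ (All.universal (λ _ ()) (support (B zero)))))
                            (trans (length-filter-suc proj₁ c (edgeList (B ∘ suc))) (count₁-edgeList (B ∘ suc) c))

count₂-edgeList : ∀ {m n} (B : Fin m → Fin n → Bool) c →
              length (filter (λ e → proj₂ e Fin.≟ c) (edgeList B)) ≡ countFin (λ x → B x c)
count₂-edgeList {zero} B c = refl
count₂-edgeList {suc m} {n} B c = begin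
  length (filter P? (edgesAt₀ B ++ edgesAt₊ B))
    ≡⟨ length-filter-++ P? (edgesAt₀ B) (edgesAt₊ B) ⟩
  length (filter P? (edgesAt₀ B)) + length (filter P? (edgesAt₊ B))
    ≡⟨ cong₂ _+_ (length-filter-map P? (zero ,_) (support (B zero)))
                 (length-filter-map P? (map₁ suc) (edgeList (B ∘ suc))) ⟩
  length (filter (Fin._≟ c) (support (B zero))) + length (filter P? (edgeList (B ∘ suc)))
    ≡⟨ cong₂ _+_ (count-support (B zero) c) (count₂-edgeList (B ∘ suc) c) ⟩
  countFin (λ x → B x c) ∎
  where
  open ≡-Reasoning
  P? : ∀ {A : Set} (e : A × Fin n) → Dec (proj₂ e ≡ c)
  P? e = proj₂ e Fin.≟ c

length-edgeList-≥ : ∀ {m n} (B : Fin m → Fin n → Bool) (S : Subset m) D →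
             (∀ {x} → x ∈ₛ S → D ≤ countFin (B x)) → ∣ S ∣ * D ≤ length (edgeList B)
length-edgeList-≥ {zero} B [] D large = z≤n
length-edgeList-≥ {suc m} B (true ∷ S) D large = begin
  D + ∣ S ∣ * D                                 ≤⟨ +-mono-≤ (large here) (length-edgeList-≥ (B ∘ suc) S D (large ∘ there)) ⟩
  countFin (B zero) + length (edgeList (B ∘ suc)) ≡⟨ length-edgeList B ⟨
  length (edgeList B)                           ∎
  where open ≤-Reasoning
length-edgeList-≥ {suc m} B (false ∷ S) D large = begin
  ∣ S ∣ * D                                     ≤⟨ m≤n+m _ (countFin (B zero)) ⟩
  countFin (B zero) + ∣ S ∣ * D                 ≤⟨ +-monoʳ-≤ _ (length-edgeList-≥ (B ∘ suc) S D (large ∘ there)) ⟩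
  countFin (B zero) + length (edgeList (B ∘ suc)) ≡⟨ length-edgeList B ⟨
  length (edgeList B)                           ∎
  where open ≤-Reasoning

countFin-mono : ∀ {n} {p q : Fin n → Bool} → (∀ x → p x ≡ true → q x ≡ true) → countFin p ≤ countFin q
countFin-mono {zero} p⇒q = z≤n
countFin-mono {suc n} {p} {q} p⇒q with p zero in p₀ | q zero in q₀
... | true  | true  = s≤s (countFin-mono (p⇒q ∘ suc))
... | true  | false with () ← trans (sym (p⇒q zero p₀)) q₀
... | false | true  = m≤n⇒m≤1+n (countFin-mono (p⇒q ∘ suc))
... | false | false = countFin-mono (p⇒q ∘ suc)

≤maxFin : ∀ {n} (f : Fin n → ℕ) x → f x ≤ maxFin f
≤maxFin {suc n} f zero = m≤m⊔n (f zero) _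
≤maxFin {suc n} f (suc x) = ≤-trans (≤maxFin (f ∘ suc) x) (m≤n⊔m (f zero) _)

minFin≤ : ∀ {n} (f : Fin n → ℕ) x → minFin f ≤ f x
minFin≤ {suc zero} f zero = ≤-refl
minFin≤ {suc (suc n)} f zero = m⊓n≤m (f zero) _
minFin≤ {suc (suc n)} f (suc x) = ≤-trans (m⊓n≤n (f zero) _) (minFin≤ (f ∘ suc) x)

module EdgesFrom {n} (G : Graph n) (S : Subset n) where
  open König (Fin._≟_ {n})

  fromS : Fin n → Fin n → Bool
  fromS x y = lookup S x ∧ adj G x y

  E : List (Fin n × Fin n)
  E = edgeList fromS

  ∣S∣*δ≤∣E∣ : ∣ S ∣ * minDegree G ≤ length E
  ∣S∣*δ≤∣E∣ = length-edgeList-≥ fromS S (minDegree G) minDegree≤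
    where
    minDegree≤ : ∀ {x} → x ∈ₛ S → minDegree G ≤ countFin (fromS x)
    minDegree≤ {x} x∈S rewrite []=⇒lookup x∈S = minFin≤ (degree G) x

  hits≤Δ : ∀ c → length (filter (λ e → hits? e c) E) ≤ maxDegree G
  hits≤Δ (inj₁ c) = begin
    length (filter (λ e → proj₁ e Fin.≟ c) E) ≡⟨ count₁-edgeList fromS c ⟩
    countFin (fromS c)                        ≤⟨ countFin-mono (λ y → ∧-conicalʳ (lookup S c) (adj G c y)) ⟩
    degree G c                                ≤⟨ ≤maxFin (degree G) c ⟩
    maxDegree G                               ∎
    where open ≤-Reasoning
  hits≤Δ (inj₂ c) = begin
    length (filter (λ e → proj₂ e Fin.≟ c) E) ≡⟨ count₂-edgeList fromS c ⟩
    countFin (λ x → fromS x c)                ≤⟨ countFin-mono (λ x → trans (Graph.sym G c x) ∘ ∧-conicalʳ (lookup S x) (adj G x c)) ⟩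
    degree G c                                ≤⟨ ≤maxFin (degree G) c ⟩
    maxDegree G                               ∎
    where open ≤-Reasoning

  Crossing : Fin n × Fin n → Set
  Crossing e = proj₁ e ∈ₛ S × ¬ (proj₂ e ∈ₛ S)

  crossing-disjoint : ∀ {e f} → Crossing e → Crossing f → Separated e f → Disjoint e f
  crossing-disjoint (a∈S , b∉S) (c∈S , d∉S) (a≢c , b≢d) =
    a≢c , (λ { refl → d∉S a∈S }) , (λ { refl → b∉S c∈S }) , b≢d

  matching⇒IsMatching : Independent G S → ∀ {M} → M ⊆ E → Matching M → IsMatching G M
  matching⇒IsMatching S-independent {M} M⊆E M-matching =
    All.tabulate (λ e∈ → adj-fromS (∈-edgeList⁻ fromS (M⊆E e∈))) ,
    allPairs-refine crossing-disjoint (All.tabulate (crossing ∘ ∈-edgeList⁻ fromS ∘ M⊆E)) M-matching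
    where
    adj-fromS : ∀ {x y} → fromS x y ≡ true → Adj G x y
    adj-fromS {x} {y} = ∧-conicalʳ (lookup S x) (adj G x y)
    crossing : ∀ {e} → fromS (proj₁ e) (proj₂ e) ≡ true → Crossing e
    crossing {x , y} e∈ = x∈S , λ y∈S → S-independent x y x∈S y∈S (adj-fromS e∈)
      where
      x∈S : x ∈ₛ S
      x∈S = lookup⇒[]= x S (∧-conicalˡ (lookup S x) (adj G x y) e∈)

δα≤Δμ : (n : ℕ) (G : Graph n) (a m : ℕ) → IsIndependenceNumber G a → IsMatchingNumber G m →
        minDegree G * a ≤ maxDegree G * m
δα≤Δμ n G a m ((S , S-independent , ∣S∣≡a) , _) (_ , maximum) = begin
  minDegree G * a               ≡⟨ *-comm (minDegree G) a ⟩
  a * minDegree G               ≡⟨ cong (_* minDegree G) ∣S∣≡a ⟨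
  ∣ S ∣ * minDegree G           ≤⟨ ∣S∣*δ≤∣E∣ ⟩
  length E                      ≤⟨ length≤cover*bound König′.hits? (maxDegree G) cover E covers hits≤Δ ⟩
  length cover * maxDegree G    ≤⟨ *-monoˡ-≤ (maxDegree G) cover≤matching ⟩
  length matching * maxDegree G ≤⟨ *-monoˡ-≤ (maxDegree G) (maximum matching M-isMatching) ⟩
  m * maxDegree G               ≡⟨ *-comm m (maxDegree G) ⟩
  maxDegree G * m               ∎
  where
  open ≤-Reasoning
  open EdgesFrom G S
  module König′ = König (Fin._≟_ {n})
  open König′.MatchingCover (König′.matchingCover E)
  M-isMatching : IsMatching G matching
  M-isMatching = matching⇒IsMatching S-independent matching⊆ isMatching

K₂ : Graph 2
K₂ = record { adj = adjacent ; sym = symmetric ; irrefl = irreflexive }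
  where
  adjacent : Fin 2 → Fin 2 → Bool
  adjacent zero zero = false
  adjacent zero (suc zero) = true
  adjacent (suc zero) zero = true
  adjacent (suc zero) (suc zero) = false
  symmetric : ∀ u v → adjacent u v ≡ adjacent v u
  symmetric zero zero = refl
  symmetric zero (suc zero) = refl
  symmetric (suc zero) zero = refl
  symmetric (suc zero) (suc zero) = refl
  irreflexive : ∀ v → adjacent v v ≡ false
  irreflexive zero = refl
  irreflexive (suc zero) = refl

α[K₂]≡1 : IsIndependenceNumber K₂ 1
α[K₂]≡1 = (true ∷ false ∷ [] , independent , refl) , maximum
  where
  independent : Independent K₂ (true ∷ false ∷ [])
  independent zero zero here here ()
  independent _ (suc zero) _ (there ()) _
  independent (suc zero) _ (there ()) _ _
  maximum : ∀ S → Independent K₂ S → ∣ S ∣ ≤ 1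
  maximum (true ∷ true ∷ []) S-independent = ⊥-elim (S-independent zero (suc zero) here (there here) refl)
  maximum (true ∷ false ∷ []) _ = ≤-refl
  maximum (false ∷ true ∷ []) _ = ≤-refl
  maximum (false ∷ false ∷ []) _ = z≤n

μ[K₂]≡1 : IsMatchingNumber K₂ 1
μ[K₂]≡1 = ((zero , suc zero) ∷ [] , (refl ∷ [] , [] ∷ []) , refl) , maximum
  where
  ¬disjoint : ∀ {a b c d : Fin 2} → Adj K₂ a b → Disjoint (a , b) (c , d) → ⊥
  ¬disjoint {zero} {zero} ()
  ¬disjoint {suc zero} {suc zero} ()
  ¬disjoint {zero} {suc zero} {zero} _ (a≢c , _) = a≢c refl
  ¬disjoint {zero} {suc zero} {suc zero} _ (_ , _ , b≢c , _) = b≢c refl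
  ¬disjoint {suc zero} {zero} {suc zero} _ (a≢c , _) = a≢c refl
  ¬disjoint {suc zero} {zero} {zero} _ (_ , _ , b≢c , _) = b≢c refl
  maximum : ∀ M → IsMatching K₂ M → length M ≤ 1
  maximum [] _ = z≤n
  maximum (_ ∷ []) _ = ≤-refl
  maximum (_ ∷ _ ∷ _) (ab ∷ _ , (ab-disjoint ∷ _) ∷ _) = ⊥-elim (¬disjoint ab ab-disjoint)

theorem2 : ((n : ℕ) (G : Graph n) (a m : ℕ) →
      IsIndependenceNumber G a → IsMatchingNumber G m →
      minDegree G * a ≤ maxDegree G * m)
    ×
    (Σ ℕ λ n → Σ (Graph n) λ G → Σ ℕ λ a → Σ ℕ λ m →
      IsIndependenceNumber G a × IsMatchingNumber G m ×
      minDegree G ≥ 1 × minDegree G * a ≡ maxDegree G * m)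
theorem2 = δα≤Δμ , (2 , K₂ , 1 , 1 , α[K₂]≡1 , μ[K₂]≡1 , ≤-refl , refl)
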